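{- Let $\Gamma=(V,E)$ be a finite vertex-transitive digraph (no loops) and let $v\in V$. For $a\in V$ let $W_a=\{x\in V:\ \Gamma(x)=\Gamma(a)\}$ be the twin class of $a$. Then the distinct sets among $\{W_a:\ a\in V\}$ form a partition of $V$, and $\Gamma^-(v)=\bigcup_{a\in\Gamma^-(v)}W_a$. Moreover $|W_v|$ divides both $|V|$ and $d(\Gamma)$. In particular, if $\gcd(|V|,d(\Gamma))=1$, then $\Gamma$ is irreducible.
   Context: For a vertex $x$, $\Gamma(x)$ denotes the set of successors (out-neighbours) of $x$ and $\Gamma^-(x)$ the set of predecessors (in-neighbours). A vertex-transitive digraph is regular; $d(\Gamma)$ denotes its degree $|\Gamma(x)|$. A pair of distinct vertices $\{x,y\}$ is a twin pair if $\Gamma(x)=\Gamma(y)$, and an anti-twin pair if $\Gamma^-(x)=\Gamma^-(y)$. A digraph is reducible if it has a twin pair or an anti-twin pair, and irreducible otherwise. -}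

module Defs where

open import Data.Nat using (ℕ)
open import Data.Bool using (Bool; true; false)
open import Data.Fin using (Fin)
open import Data.Fin.Subset using (Subset; _∈_; _∉_; ∣_∣)
open import Data.Vec using (tabulate)
open import Data.Vec.Properties using (≡-dec)
open import Data.Bool.Properties using () renaming (_≟_ to _≟ᵇ_)
open import Data.Product using (_×_; ∃-syntax)
open import Relation.Nullary using (¬_; does)
open import Relation.Binary.PropositionalEquality using (_≡_; _≢_)
open import Function.Bundles using (_↔_; Inverse)

record Digraph (n : ℕ) : Set where
  field
    adj : Fin n → Fin n → Bool

module _ {n : ℕ} (Γ : Digraph n) where
  open Digraph Γ

  Loopless : Set
  Loopless = ∀ x → adj x x ≡ false

  IsAutomorphism : (Fin n ↔ Fin n) → Set
  IsAutomorphism σ = ∀ x y → adj (Inverse.to σ x) (Inverse.to σ y) ≡ adj x y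

  VertexTransitive : Set
  VertexTransitive = ∀ x y → ∃[ σ ] (IsAutomorphism σ × Inverse.to σ x ≡ y)

  out : Fin n → Subset n
  out x = tabulate (λ z → adj x z)

  inn : Fin n → Subset n
  inn x = tabulate (λ z → adj z x)

  -- degree d(Γ), measured at vertex v (Γ is regular when vertex-transitive)
  degreeAt : Fin n → ℕ
  degreeAt v = ∣ out v ∣

  W : Fin n → Subset n
  W a = tabulate (λ x → does (≡-dec _≟ᵇ_ (out x) (out a)))

  Irreducible : Set
  Irreducible = ∀ x y → x ≢ y → (out x ≢ out y) × (inn x ≢ inn y)

module Submission where

-- The twin classes W_a are the fibres of the map  a ↦ Γ(a).
--
--  * Counting: we count boolean predicates on Fin n as sums of 0/1 values,
--    so that the summation library provides invariance under permutations
--    and interchange of double sums.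
--  * Fibres of a map key : Fin n → A: fibres partition Fin n, a saturated set
--    (a union of fibres) is the union of the fibres through its points, and
--    if all fibres have the same size k then k divides the size of every
--    saturated set (remove one fibre and use strong induction).
--  * Vertex transitivity: any vertex statistic defined invariantly under
--    automorphisms (out-degree, in-degree, size of the twin class) is
--    independent of the vertex; double counting arcs then gives
--    in-degree = out-degree.
--
-- Taking the saturated sets Fin n and Γ⁻(v) shows |W_v| ∣ n and
-- |W_v| ∣ d(Γ).  If gcd(n, d(Γ)) = 1 all twin classes are singletons, so
-- there are no twin pairs; anti-twins of Γ are twins of the reverse digraph,
-- which is again vertex-transitive with the same degree.

open import Defs
open import Data.Nat using (ℕ; zero; suc; _+_; _*_; _≤_; _<_; s≤s; z≤n)
open import Data.Nat.Properties
  using (+-0-commutativeMonoid; +-mono-≤; ≤-trans; m≤n+m; m<n+m; *-cancelˡ-≡; *-identityʳ; 1+n≢0)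
open import Data.Nat.Divisibility using (_∣_; _∣0; ∣-reflexive; ∣m∣n⇒∣m+n; ∣1⇒≡1)
open import Data.Nat.GCD using (gcd; gcd-greatest)
open import Data.Nat.Induction using (<-rec)
open import Data.Bool using (Bool; true; false; _∧_; not)
open import Data.Bool.Properties using (∧-identityʳ; ∧-zeroʳ) renaming (_≟_ to _≟ᵇ_)
open import Data.Fin using (Fin; zero; suc)
open import Data.Fin.Properties using (nonZeroIndex) renaming (_≟_ to _≟ᶠ_)
open import Data.Fin.Subset using (_∈_; _∉_; ∣_∣)
open import Data.Vec using (tabulate; lookup)
open import Data.Vec.Properties using (≡-dec; lookup∘tabulate; tabulate-cong; []=⇒lookup; lookup⇒[]=)
open import Data.Product using (_×_; _,_; ∃-syntax)
open import Data.Sum using (_⊎_; inj₁; inj₂)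
open import Data.Empty using (⊥-elim)
open import Relation.Nullary using (¬_; does; yes; no)
open import Relation.Nullary.Decidable using (dec-true; dec-false; does-⇔)
open import Relation.Binary.Definitions using (DecidableEquality)
open import Relation.Binary.PropositionalEquality
  using (_≡_; _≢_; refl; sym; trans; cong; cong₂; subst; module ≡-Reasoning)
open import Function using (_∘_)
open import Function.Bundles using (_↔_; Inverse; Equivalence; _⇔_; mk⇔)
open Digraph using (adj)
import Algebra.Properties.CommutativeMonoid.Sum as SumProperties

open ≡-Reasoning

open SumProperties +-0-commutativeMonoid
  using (sum; sum-syntax; sum-cong-≗; ∑-distrib-+; ∑-comm; ∑-permute)

𝟙 : Bool → ℕ
𝟙 true  = 1
𝟙 false = 0

count : ∀ {n} → (Fin n → Bool) → ℕ
count f = ∑[ i < _ ] 𝟙 (f i)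

∣tabulate∣≡count : ∀ {n} (f : Fin n → Bool) → ∣ tabulate f ∣ ≡ count f
∣tabulate∣≡count {zero}  f = refl
∣tabulate∣≡count {suc n} f with f zero
... | true  = cong suc (∣tabulate∣≡count (f ∘ suc))
... | false = ∣tabulate∣≡count (f ∘ suc)

tabulate-∈ : ∀ {n} (f : Fin n → Bool) {x} → f x ≡ true → x ∈ tabulate f
tabulate-∈ f {x} fx = lookup⇒[]= x (tabulate f) (trans (lookup∘tabulate f x) fx)

∈-tabulate : ∀ {n} (f : Fin n → Bool) {x} → x ∈ tabulate f → f x ≡ true
∈-tabulate f {x} x∈ = trans (sym (lookup∘tabulate f x)) ([]=⇒lookup x∈)

count-cong : ∀ {n} {f g : Fin n → Bool} → (∀ i → f i ≡ g i) → count f ≡ count g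
count-cong f≗g = sum-cong-≗ (cong 𝟙 ∘ f≗g)

count-permute : ∀ {n} (f : Fin n → Bool) (σ : Fin n ↔ Fin n) →
                count (f ∘ Inverse.to σ) ≡ count f
count-permute f σ = sym (∑-permute (𝟙 ∘ f) σ)

count-split : ∀ {n} (f g : Fin n → Bool) →
              count f ≡ count (λ i → f i ∧ g i) + count (λ i → f i ∧ not (g i))
count-split f g = trans (sum-cong-≗ (λ i → split (f i) (g i)))
                        (∑-distrib-+ (λ i → 𝟙 (f i ∧ g i)) (λ i → 𝟙 (f i ∧ not (g i))))
  where
  split : ∀ a b → 𝟙 a ≡ 𝟙 (a ∧ b) + 𝟙 (a ∧ not b)
  split true  true  = refl
  split true  false = refl
  split false _     = refl

sum-const : ∀ n c → ∑[ i < n ] c ≡ n * c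
sum-const zero    c = refl
sum-const (suc n) c = cong (c +_) (sum-const n c)

count-all : ∀ n → count {n} (λ _ → true) ≡ n
count-all n = trans (sum-const n 1) (*-identityʳ n)

count-pos : ∀ {n} (f : Fin n → Bool) x → f x ≡ true → 1 ≤ count f
count-pos f zero    fx rewrite fx = s≤s z≤n
count-pos f (suc x) fx = ≤-trans (count-pos (f ∘ suc) x fx) (m≤n+m _ (𝟙 (f zero)))

count-two : ∀ {n} (f : Fin n → Bool) x y → f x ≡ true → f y ≡ true → x ≢ y → 2 ≤ count f
count-two f x y fx fy x≢y = subst (2 ≤_) (sym (count-split f is-x))
  (+-mono-≤ (count-pos _ x (cong₂ _∧_ fx (dec-true (x ≟ᶠ x) refl)))
            (count-pos _ y (cong₂ _∧_ fy (cong not (dec-false (y ≟ᶠ x) (x≢y ∘ sym))))))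
  where
  is-x : _ → Bool
  is-x i = does (i ≟ᶠ x)

count-witness : ∀ {n} (f : Fin n → Bool) → count f ≢ 0 → ∃[ x ] f x ≡ true
count-witness {zero}  f nonempty = ⊥-elim (nonempty refl)
count-witness {suc n} f nonempty with f zero in f0
... | true  = zero , f0
... | false with count-witness (f ∘ suc) nonempty
...   | x , fx = suc x , fx

module Fibres {n : ℕ} {A : Set} (_≟_ : DecidableEquality A) (key : Fin n → A) where

  fibre : Fin n → Fin n → Bool
  fibre a x = does (key x ≟ key a)

  fibre-complete : ∀ {a x} → key x ≡ key a → fibre a x ≡ true
  fibre-complete {a} {x} = dec-true (key x ≟ key a)

  fibre-sound : ∀ {a x} → fibre a x ≡ true → key x ≡ key a
  fibre-sound {a} {x} _ with key x ≟ key a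
  fibre-sound         _  | yes e = e
  fibre-sound         () | no _

  fibre-cong : ∀ {a b} → key a ≡ key b → fibre a ≡ fibre b
  fibre-cong e = cong (λ k x → does (key x ≟ k)) e

  fibre-partition : ∀ a b → fibre a ≡ fibre b ⊎ (∀ x → fibre a x ≡ true → fibre b x ≢ true)
  fibre-partition a b with key a ≟ key b
  ... | yes e = inj₁ (fibre-cong e)
  ... | no ne = inj₂ (λ x xa xb → ne (trans (sym (fibre-sound xa)) (fibre-sound xb)))

  Saturated : (Fin n → Bool) → Set
  Saturated S = ∀ x y → key x ≡ key y → S x ≡ S y

  fibre-saturated : ∀ a → Saturated (fibre a)
  fibre-saturated a x y e =
    does-⇔ (mk⇔ (trans (sym e)) (trans e)) (key x ≟ key a) (key y ≟ key a)

  saturated-union : ∀ {S} → Saturated S → ∀ x →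
                    S x ≡ true ⇔ (∃[ a ] (S a ≡ true × fibre a x ≡ true))
  saturated-union sat x = mk⇔ (λ Sx → x , Sx , fibre-complete refl)
                              (λ { (a , Sa , xa) → trans (sat x a (fibre-sound xa)) Sa })

  _∖_ : (Fin n → Bool) → Fin n → (Fin n → Bool)
  (S ∖ x) y = S y ∧ not (fibre x y)

  ∖-saturated : ∀ {S} → Saturated S → ∀ x → Saturated (S ∖ x)
  ∖-saturated sat x y z e = cong₂ _∧_ (sat y z e) (cong not (fibre-saturated x y z e))

  count-∖ : ∀ {S} → Saturated S → ∀ {x} → S x ≡ true →
            count S ≡ count (fibre x) + count (S ∖ x)
  count-∖ {S} sat {x} Sx =
    trans (count-split S (fibre x)) (cong (_+ count (S ∖ x)) (count-cong fibre⊆S))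
    where
    fibre⊆S : ∀ y → S y ∧ fibre x y ≡ fibre x y
    fibre⊆S y with fibre x y in xy
    ... | true  = trans (∧-identityʳ (S y)) (trans (sat y x (fibre-sound xy)) Sx)
    ... | false = ∧-zeroʳ (S y)

  -- If all fibres have size k, then k divides the size of every saturated
  -- set: by strong induction on its size, removing one fibre at a time.
  saturated-divisible : ∀ {k} → (∀ a → count (fibre a) ≡ k) →
                        ∀ S → Saturated S → k ∣ count S
  saturated-divisible {k} uniform S sat = <-rec P step (count S) S sat refl
    where
    P : ℕ → Set
    P m = ∀ S → Saturated S → count S ≡ m → k ∣ m

    step : ∀ m → (∀ {m′} → m′ < m → P m′) → P m
    step zero    _  _ _   _      = k ∣0
    step (suc m) ih S sat count≡ with count-witness S (λ e → 1+n≢0 (trans (sym count≡) e))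
    ... | x , Sx = subst (k ∣_) (trans (sym split) count≡)
                     (∣m∣n⇒∣m+n (∣-reflexive (sym (uniform x)))
                                (ih smaller (S ∖ x) (∖-saturated sat x) refl))
      where
      split : count S ≡ count (fibre x) + count (S ∖ x)
      split = count-∖ sat Sx
      smaller : count (S ∖ x) < suc m
      smaller = subst (count (S ∖ x) <_) (trans (sym split) count≡)
                      (m<n+m _ (count-pos (fibre x) x (fibre-complete refl)))

-- The twin classes of a digraph are the fibres of  x ↦ Γ(x);
-- by definition  W Γ a ≡ tabulate (twin a).
module Twins {n : ℕ} (Γ : Digraph n) = Fibres (≡-dec _≟ᵇ_) (out Γ)
  renaming (fibre to twin; fibre-complete to twin-complete)

module _ {n : ℕ} (Γ : Digraph n) where
  open Twins Γ

  twins⇒arcs : ∀ {x a} → out Γ x ≡ out Γ a → ∀ z → adj Γ x z ≡ adj Γ a z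
  twins⇒arcs {x} {a} e z = begin
    adj Γ x z          ≡⟨ lookup∘tabulate (adj Γ x) z ⟨
    lookup (out Γ x) z ≡⟨ cong (λ o → lookup o z) e ⟩
    lookup (out Γ a) z ≡⟨ lookup∘tabulate (adj Γ a) z ⟩
    adj Γ a z          ∎

  W-reflexive : ∀ a → a ∈ W Γ a
  W-reflexive a = tabulate-∈ (twin a) (twin-complete refl)

  W-partition : ∀ a b → W Γ a ≡ W Γ b ⊎ (∀ x → x ∈ W Γ a → x ∉ W Γ b)
  W-partition a b with fibre-partition a b
  ... | inj₁ e        = inj₁ (cong tabulate e)
  ... | inj₂ disjoint =
    inj₂ (λ x x∈a x∈b → disjoint x (∈-tabulate (twin a) x∈a) (∈-tabulate (twin b) x∈b))

  inn-saturated : ∀ v → Saturated (λ z → adj Γ z v)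
  inn-saturated v x y e = twins⇒arcs e v

  inn-union : ∀ v x → (x ∈ inn Γ v) ⇔ (∃[ a ] (a ∈ inn Γ v × x ∈ W Γ a))
  inn-union v x = mk⇔
    (λ x∈ → let (a , a∈ , xa) = to (∈-tabulate (λ z → adj Γ z v) x∈)
            in a , tabulate-∈ (λ z → adj Γ z v) a∈ , tabulate-∈ (twin a) xa)
    (λ { (a , a∈ , x∈a) → tabulate-∈ (λ z → adj Γ z v)
           (from (a , ∈-tabulate (λ z → adj Γ z v) a∈ , ∈-tabulate (twin a) x∈a)) })
    where open Equivalence (saturated-union (inn-saturated v) x)

  automorphism-twin : ∀ σ → IsAutomorphism Γ σ → ∀ a x →
                      twin (Inverse.to σ a) (Inverse.to σ x) ≡ twin a x
  automorphism-twin σ aut a x =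
    does-⇔ (mk⇔ reflect preserve) (out Γ (f x) ≟ᵒ out Γ (f a)) (out Γ x ≟ᵒ out Γ a)
    where
    open Inverse σ using () renaming (to to f; from to f⁻¹; strictlyInverseˡ to ff⁻¹)
    _≟ᵒ_ = ≡-dec _≟ᵇ_

    reflect : out Γ (f x) ≡ out Γ (f a) → out Γ x ≡ out Γ a
    reflect e = tabulate-cong λ z → begin
      adj Γ x z         ≡⟨ aut x z ⟨
      adj Γ (f x) (f z) ≡⟨ twins⇒arcs e (f z) ⟩
      adj Γ (f a) (f z) ≡⟨ aut a z ⟩
      adj Γ a z         ∎

    preserve : out Γ x ≡ out Γ a → out Γ (f x) ≡ out Γ (f a)
    preserve e = tabulate-cong λ z → begin
      adj Γ (f x) z            ≡⟨ cong (adj Γ (f x)) (ff⁻¹ z) ⟨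
      adj Γ (f x) (f (f⁻¹ z))  ≡⟨ aut x (f⁻¹ z) ⟩
      adj Γ x (f⁻¹ z)          ≡⟨ twins⇒arcs e (f⁻¹ z) ⟩
      adj Γ a (f⁻¹ z)          ≡⟨ aut a (f⁻¹ z) ⟨
      adj Γ (f a) (f (f⁻¹ z))  ≡⟨ cong (adj Γ (f a)) (ff⁻¹ z) ⟩
      adj Γ (f a) z            ∎

  module _ (vt : VertexTransitive Γ) where

    invariant-count : (P : Fin n → Fin n → Bool) →
                      (∀ σ → IsAutomorphism Γ σ → ∀ a x → P (Inverse.to σ a) (Inverse.to σ x) ≡ P a x) →
                      ∀ a b → count (P a) ≡ count (P b)
    invariant-count P invariant a b with vt a b
    ... | σ , aut , refl = begin
      count (P a)                                    ≡⟨ count-cong (sym ∘ invariant σ aut a) ⟩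
      count (P (Inverse.to σ a) ∘ Inverse.to σ)      ≡⟨ count-permute (P (Inverse.to σ a)) σ ⟩
      count (P (Inverse.to σ a))                     ∎

    outdegree-constant : ∀ a b → count (adj Γ a) ≡ count (adj Γ b)
    outdegree-constant = invariant-count (adj Γ) (λ σ aut → aut)

    indegree-constant : ∀ a b → count (λ z → adj Γ z a) ≡ count (λ z → adj Γ z b)
    indegree-constant = invariant-count (λ a z → adj Γ z a) (λ σ aut a z → aut z a)

    twinClass-constant : ∀ a b → ∣ W Γ a ∣ ≡ ∣ W Γ b ∣
    twinClass-constant a b = begin
      ∣ W Γ a ∣       ≡⟨ ∣tabulate∣≡count (twin a) ⟩
      count (twin a)  ≡⟨ invariant-count twin automorphism-twin a b ⟩
      count (twin b)  ≡⟨ ∣tabulate∣≡count (twin b) ⟨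
      ∣ W Γ b ∣       ∎

    -- Double counting the arcs: n · d⁻(v) = Σ_y d⁻(y) = Σ_z d⁺(z) = n · d⁺(v).
    indegree≡outdegree : ∀ v → count (λ z → adj Γ z v) ≡ count (adj Γ v)
    indegree≡outdegree v = *-cancelˡ-≡ _ _ n {{nonZeroIndex v}} (begin
      n * count (λ z → adj Γ z v)        ≡⟨ sum-const n _ ⟨
      ∑[ y < n ] count (λ z → adj Γ z v) ≡⟨ sum-cong-≗ (indegree-constant v) ⟩
      ∑[ y < n ] ∑[ z < n ] 𝟙 (adj Γ z y) ≡⟨ ∑-comm (λ y z → 𝟙 (adj Γ z y)) ⟩
      ∑[ z < n ] ∑[ y < n ] 𝟙 (adj Γ z y) ≡⟨ sum-cong-≗ (λ z → outdegree-constant z v) ⟩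
      ∑[ z < n ] count (adj Γ v)         ≡⟨ sum-const n _ ⟩
      n * count (adj Γ v)                ∎)

    twinClass-divides : ∀ v S → Saturated S → ∣ W Γ v ∣ ∣ count S
    twinClass-divides v = saturated-divisible uniform
      where
      uniform : ∀ a → count (twin a) ≡ ∣ W Γ v ∣
      uniform a = trans (sym (∣tabulate∣≡count (twin a))) (twinClass-constant a v)

    twinClass∣order : ∀ v → ∣ W Γ v ∣ ∣ n
    twinClass∣order v =
      subst (∣ W Γ v ∣ ∣_) (count-all n) (twinClass-divides v (λ _ → true) (λ _ _ _ → refl))

    twinClass∣degree : ∀ v → ∣ W Γ v ∣ ∣ degreeAt Γ v
    twinClass∣degree v =
      subst (∣ W Γ v ∣ ∣_) (trans (indegree≡outdegree v) (sym (∣tabulate∣≡count (adj Γ v))))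
            (twinClass-divides v (λ z → adj Γ z v) (inn-saturated v))

    no-twins : ∀ v → gcd n (degreeAt Γ v) ≡ 1 → ∀ x y → x ≢ y → out Γ x ≢ out Γ y
    no-twins v coprime x y x≢y twins =
      2≰1 (subst (2 ≤_) size≡1
        (count-two (twin x) x y (twin-complete refl) (twin-complete (sym twins)) x≢y))
      where
      2≰1 : ¬ 2 ≤ 1
      2≰1 (s≤s ())

      ∣W_v∣≡1 : ∣ W Γ v ∣ ≡ 1
      ∣W_v∣≡1 = ∣1⇒≡1 (subst (∣ W Γ v ∣ ∣_) coprime
                               (gcd-greatest (twinClass∣order v) (twinClass∣degree v)))

      size≡1 : count (twin x) ≡ 1
      size≡1 = begin
        count (twin x) ≡⟨ ∣tabulate∣≡count (twin x) ⟨
        ∣ W Γ x ∣      ≡⟨ twinClass-constant x v ⟩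
        ∣ W Γ v ∣      ≡⟨ ∣W_v∣≡1 ⟩
        1              ∎

-- The reverse digraph: its twin pairs are the anti-twin pairs of Γ,
-- since  out (reverse Γ) x  and  inn Γ x  are definitionally equal.
reverse : ∀ {n} → Digraph n → Digraph n
reverse Γ = record { adj = λ x y → adj Γ y x }

reverse-vertexTransitive : ∀ {n} (Γ : Digraph n) → VertexTransitive Γ → VertexTransitive (reverse Γ)
reverse-vertexTransitive Γ vt x y with vt x y
... | σ , aut , σx≡y = σ , (λ a b → aut b a) , σx≡y

-- Reversing arcs swaps in- and out-degree, which agree by regularity.
reverse-degree : ∀ {n} (Γ : Digraph n) → VertexTransitive Γ → ∀ v →
                 degreeAt (reverse Γ) v ≡ degreeAt Γ v
reverse-degree Γ vt v = begin
  ∣ inn Γ v ∣                ≡⟨ ∣tabulate∣≡count (λ z → adj Γ z v) ⟩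
  count (λ z → adj Γ z v)    ≡⟨ indegree≡outdegree Γ vt v ⟩
  count (adj Γ v)            ≡⟨ ∣tabulate∣≡count (adj Γ v) ⟨
  ∣ out Γ v ∣                ∎

coprime⇒irreducible : ∀ {n} (Γ : Digraph n) → VertexTransitive Γ → ∀ v →
                      gcd n (degreeAt Γ v) ≡ 1 → Irreducible Γ
coprime⇒irreducible {n} Γ vt v coprime x y x≢y =
  no-twins Γ vt v coprime x y x≢y ,
  no-twins (reverse Γ) (reverse-vertexTransitive Γ vt) v
           (trans (cong (gcd n) (reverse-degree Γ vt v)) coprime) x y x≢y

lemma3 : ∀ {n : ℕ} (Γ : Digraph n) → Loopless Γ → VertexTransitive Γ → (v : Fin n) →
    ((∀ a → a ∈ W Γ a)
      × (∀ a b → W Γ a ≡ W Γ b ⊎ (∀ x → x ∈ W Γ a → x ∉ W Γ b)))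
    × (∀ x → (x ∈ inn Γ v) ⇔ (∃[ a ] (a ∈ inn Γ v × x ∈ W Γ a)))
    × (∣ W Γ v ∣ ∣ n)
    × (∣ W Γ v ∣ ∣ degreeAt Γ v)
    × (gcd n (degreeAt Γ v) ≡ 1 → Irreducible Γ)
lemma3 Γ _ vt v =
  (W-reflexive Γ , W-partition Γ) ,
  inn-union Γ v ,
  twinClass∣order Γ vt v ,
  twinClass∣degree Γ vt v ,
  coprime⇒irreducible Γ vt v
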